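{- Let $p_0,p_1,p_2$ be positive integers with $\gcd(p_0,p_1,p_2)=1$, and put $n=p_0+p_1+p_2$. Let $E=(\mathbb{Z}/n\mathbb{Z})\times\{0,1,2\}$, and let $\sigma_0,\sigma_1$ be the permutations of $E$ defined for $m\in\mathbb{Z}/n\mathbb{Z}$ by $$\sigma_0(m,0)=(m,1),\quad \sigma_0(m,1)=(m,2),\quad \sigma_0(m,2)=(m,0),$$ $$\sigma_1(m,0)=(m-p_1,2),\quad \sigma_1(m,1)=(m-p_2,0),\quad \sigma_1(m,2)=(m-p_0,1).$$ Let $N=\langle\sigma_0\sigma_1,\sigma_1\sigma_0\rangle$ and $H=\langle\sigma_0\rangle$. Then $N\cap H=\{\mathrm{id}\}$.
   Context: Composition of permutations is as functions: $(\sigma\tau)(x)=\sigma(\tau(x))$. -}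

module Defs where

open import Data.Nat using (ℕ; zero; suc; _+_; _∸_)
open import Data.Nat.DivMod using (_mod_; _%_)
open import Data.Fin using (Fin; toℕ; zero; suc)
open import Data.Product using (_×_; _,_)
open import Data.List using (List)
open import Data.List.Membership.Propositional using (_∈_)
open import Relation.Binary.PropositionalEquality using (_≡_)
open import Function using (_∘_; id)

E : ℕ → Set
E n = Fin n × Fin 3

subMod : (n : ℕ) → Fin n → ℕ → Fin n
subMod (suc k) m p = (toℕ m + (suc k ∸ (p % suc k))) mod (suc k)

σ₀ : (n : ℕ) → E n → E n
σ₀ n (m , zero)             = (m , suc zero)
σ₀ n (m , suc zero)         = (m , suc (suc zero))
σ₀ n (m , suc (suc zero))   = (m , zero)

σ₁ : (p₀ p₁ p₂ : ℕ) → E (p₀ + p₁ + p₂) → E (p₀ + p₁ + p₂)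
σ₁ p₀ p₁ p₂ (m , zero)           = (subMod (p₀ + p₁ + p₂) m p₁ , suc (suc zero))
σ₁ p₀ p₁ p₂ (m , suc zero)       = (subMod (p₀ + p₁ + p₂) m p₂ , zero)
σ₁ p₀ p₁ p₂ (m , suc (suc zero)) = (subMod (p₀ + p₁ + p₂) m p₀ , suc zero)

-- The subgroup of Sym(X) generated by a list of (bijective) maps X → X,
-- with maps identified up to pointwise equality.
data ⟨_⟩ {X : Set} (S : List (X → X)) : (X → X) → Set where
  gen  : ∀ {s} → s ∈ S → ⟨ S ⟩ s
  unit : ⟨ S ⟩ id
  comp : ∀ {f g} → ⟨ S ⟩ f → ⟨ S ⟩ g → ⟨ S ⟩ (f ∘ g)
  inv  : ∀ {f g} → ⟨ S ⟩ f → (∀ x → g (f x) ≡ x) → (∀ x → f (g x) ≡ x) → ⟨ S ⟩ g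
  ext  : ∀ {f g} → ⟨ S ⟩ f → (∀ x → f x ≡ g x) → ⟨ S ⟩ g

{-# OPTIONS --safe #-}
-- Both generators σ₀σ₁ and σ₁σ₀ of N fix the level (second coordinate) of every
-- point, since σ₁ lowers the level by one and σ₀ raises it by one; hence so does
-- every element of N. As σ₀ has order 3, H = {id, σ₀, σ₀²}, and σ₀, σ₀² change
-- the level of every point. So the only element of H in N is the identity.
module Submission where

open import Defs
open import Data.Nat using (ℕ; _+_; _<_)
open import Data.Nat.GCD using (gcd)
open import Data.Fin using (zero; suc)
open import Data.Product using (_,_; proj₂)
open import Data.Sum using (_⊎_; inj₁; inj₂)
open import Data.List using (_∷_; [])
open import Data.List.Relation.Unary.All using (All; _∷_; []; lookup)
open import Data.List.Relation.Unary.Any using (here)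
open import Data.Empty using (⊥-elim)
open import Relation.Binary.PropositionalEquality
  using (_≡_; _≢_; _≗_; refl; sym; trans; cong)
open import Function using (_∘_; id)

module _ {X : Set} where

  Preserves : {Y : Set} → (X → Y) → (X → X) → Set
  Preserves π f = ∀ x → π (f x) ≡ π x

  ⟨⟩-preserves : ∀ {Y} (π : X → Y) {S f} → All (Preserves π) S → ⟨ S ⟩ f → Preserves π f
  ⟨⟩-preserves π all (gen s∈S)           = lookup all s∈S
  ⟨⟩-preserves π all unit              x = refl
  ⟨⟩-preserves π all (comp {g = g} a b) x =
    trans (⟨⟩-preserves π all a (g x)) (⟨⟩-preserves π all b x)
  ⟨⟩-preserves π all (inv {g = g} a _ fg) x =
    trans (sym (⟨⟩-preserves π all a (g x))) (cong π (fg x))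
  ⟨⟩-preserves π all (ext a f≗g)       x =
    trans (cong π (sym (f≗g x))) (⟨⟩-preserves π all a x)

  module _ (σ : X → X) (σ³≗id : ∀ x → σ (σ (σ x)) ≡ x) where

    PowerOf : (X → X) → Set
    PowerOf f = f ≗ id ⊎ f ≗ σ ⊎ f ≗ σ ∘ σ

    PowerOf-resp-≗ : ∀ {f g} → f ≗ g → PowerOf f → PowerOf g
    PowerOf-resp-≗ f≗g (inj₁ h)        = inj₁ λ x → trans (sym (f≗g x)) (h x)
    PowerOf-resp-≗ f≗g (inj₂ (inj₁ h)) = inj₂ (inj₁ λ x → trans (sym (f≗g x)) (h x))
    PowerOf-resp-≗ f≗g (inj₂ (inj₂ h)) = inj₂ (inj₂ λ x → trans (sym (f≗g x)) (h x))

    PowerOf-∘ : ∀ {f g} → PowerOf f → PowerOf g → PowerOf (f ∘ g)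
    PowerOf-∘ {f} {g} (inj₁ a) b = PowerOf-resp-≗ (λ x → sym (a (g x))) b
    PowerOf-∘ {f} {g} (inj₂ (inj₁ a)) (inj₁ b) =
      inj₂ (inj₁ λ x → trans (a (g x)) (cong σ (b x)))
    PowerOf-∘ {f} {g} (inj₂ (inj₁ a)) (inj₂ (inj₁ b)) =
      inj₂ (inj₂ λ x → trans (a (g x)) (cong σ (b x)))
    PowerOf-∘ {f} {g} (inj₂ (inj₁ a)) (inj₂ (inj₂ b)) =
      inj₁ λ x → trans (a (g x)) (trans (cong σ (b x)) (σ³≗id x))
    PowerOf-∘ {f} {g} (inj₂ (inj₂ a)) (inj₁ b) =
      inj₂ (inj₂ λ x → trans (a (g x)) (cong (σ ∘ σ) (b x)))
    PowerOf-∘ {f} {g} (inj₂ (inj₂ a)) (inj₂ (inj₁ b)) =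
      inj₁ λ x → trans (a (g x)) (trans (cong (σ ∘ σ) (b x)) (σ³≗id x))
    PowerOf-∘ {f} {g} (inj₂ (inj₂ a)) (inj₂ (inj₂ b)) =
      inj₂ (inj₁ λ x → trans (a (g x)) (trans (cong (σ ∘ σ) (b x)) (cong σ (σ³≗id x))))

    -- The left inverse of σᵏ is σ³⁻ᵏ: evaluate it at σ³⁻ᵏ x and use σ³ ≗ id.
    PowerOf-leftInverse : ∀ {f g} → PowerOf f → (∀ x → g (f x) ≡ x) → PowerOf g
    PowerOf-leftInverse {f} {g} (inj₁ a) gf = inj₁ λ x → trans (cong g (sym (a x))) (gf x)
    PowerOf-leftInverse {f} {g} (inj₂ (inj₁ a)) gf = inj₂ (inj₂ λ x →
      trans (cong g (sym (trans (a (σ (σ x))) (σ³≗id x)))) (gf (σ (σ x))))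
    PowerOf-leftInverse {f} {g} (inj₂ (inj₂ a)) gf = inj₂ (inj₁ λ x →
      trans (cong g (sym (trans (a (σ x)) (σ³≗id x)))) (gf (σ x)))

    ⟨⟩-PowerOf : ∀ {f} → ⟨ σ ∷ [] ⟩ f → PowerOf f
    ⟨⟩-PowerOf (gen (here refl)) = inj₂ (inj₁ λ _ → refl)
    ⟨⟩-PowerOf unit            = inj₁ λ _ → refl
    ⟨⟩-PowerOf (comp a b)      = PowerOf-∘ (⟨⟩-PowerOf a) (⟨⟩-PowerOf b)
    ⟨⟩-PowerOf (inv a gf _)    = PowerOf-leftInverse (⟨⟩-PowerOf a) gf
    ⟨⟩-PowerOf (ext a f≗g)     = PowerOf-resp-≗ f≗g (⟨⟩-PowerOf a)

    ⟨⟩-preserves⇒id : ∀ {Y} (π : X → Y) → (∀ x → π (σ x) ≢ π x) → (∀ x → π (σ (σ x)) ≢ π x) →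
                      ∀ {f} → ⟨ σ ∷ [] ⟩ f → Preserves π f → f ≗ id
    ⟨⟩-preserves⇒id π σ-moves σ²-moves f∈H f-fixes x with ⟨⟩-PowerOf f∈H
    ... | inj₁ f≗id        = f≗id x
    ... | inj₂ (inj₁ f≗σ)  = ⊥-elim (σ-moves x (trans (cong π (sym (f≗σ x))) (f-fixes x)))
    ... | inj₂ (inj₂ f≗σ²) = ⊥-elim (σ²-moves x (trans (cong π (sym (f≗σ² x))) (f-fixes x)))

σ₀³≗id : ∀ n (x : E n) → σ₀ n (σ₀ n (σ₀ n x)) ≡ x
σ₀³≗id n (m , zero)             = refl
σ₀³≗id n (m , suc zero)         = refl
σ₀³≗id n (m , suc (suc zero))   = refl

σ₀-moves-level : ∀ n (x : E n) → proj₂ (σ₀ n x) ≢ proj₂ x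
σ₀-moves-level n (m , zero)           ()
σ₀-moves-level n (m , suc zero)       ()
σ₀-moves-level n (m , suc (suc zero)) ()

σ₀²-moves-level : ∀ n (x : E n) → proj₂ (σ₀ n (σ₀ n x)) ≢ proj₂ x
σ₀²-moves-level n (m , zero)           ()
σ₀²-moves-level n (m , suc zero)       ()
σ₀²-moves-level n (m , suc (suc zero)) ()

module _ (p₀ p₁ p₂ : ℕ) where

  private
    n : ℕ
    n = p₀ + p₁ + p₂

  σ₀σ₁-preserves-level : Preserves proj₂ (σ₀ n ∘ σ₁ p₀ p₁ p₂)
  σ₀σ₁-preserves-level (m , zero)           = refl
  σ₀σ₁-preserves-level (m , suc zero)       = refl
  σ₀σ₁-preserves-level (m , suc (suc zero)) = refl

  σ₁σ₀-preserves-level : Preserves proj₂ (σ₁ p₀ p₁ p₂ ∘ σ₀ n)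
  σ₁σ₀-preserves-level (m , zero)           = refl
  σ₁σ₀-preserves-level (m , suc zero)       = refl
  σ₁σ₀-preserves-level (m , suc (suc zero)) = refl

lemma5 : (p₀ p₁ p₂ : ℕ) → 0 < p₀ → 0 < p₁ → 0 < p₂ → gcd (gcd p₀ p₁) p₂ ≡ 1 →
    (f : E (p₀ + p₁ + p₂) → E (p₀ + p₁ + p₂)) →
    ⟨ (σ₀ (p₀ + p₁ + p₂) ∘ σ₁ p₀ p₁ p₂) ∷ (σ₁ p₀ p₁ p₂ ∘ σ₀ (p₀ + p₁ + p₂)) ∷ [] ⟩ f →
    ⟨ σ₀ (p₀ + p₁ + p₂) ∷ [] ⟩ f →
    ∀ x → f x ≡ x
lemma5 p₀ p₁ p₂ _ _ _ _ f f∈N f∈H =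
  ⟨⟩-preserves⇒id (σ₀ n) (σ₀³≗id n) proj₂ (σ₀-moves-level n) (σ₀²-moves-level n)
    f∈H (⟨⟩-preserves proj₂ generators-preserve-level f∈N)
  where
  n : ℕ
  n = p₀ + p₁ + p₂
  generators-preserve-level :
    All (Preserves proj₂) ((σ₀ n ∘ σ₁ p₀ p₁ p₂) ∷ (σ₁ p₀ p₁ p₂ ∘ σ₀ n) ∷ [])
  generators-preserve-level =
    σ₀σ₁-preserves-level p₀ p₁ p₂ ∷ σ₁σ₀-preserves-level p₀ p₁ p₂ ∷ []
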